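{- Let $\mathcal{M}$ be a $t\times u$ matrix with entries in $\{0,1,-1\}$. Then the row-column graph of $\mathcal{M}$ is a forest if and only if the cell graph of $\mathcal{M}$ is a forest.
   Context: Matrices are indexed with $\mathcal{M}_{k,\ell}$ denoting the entry in the $k$th column from the left and $\ell$th row from the bottom; a $t\times u$ matrix has $t$ columns and $u$ rows. The row-column graph of $\mathcal{M}$ is the bipartite graph on vertices $x_1,\dots,x_t,y_1,\dots,y_u$ in which $x_i\sim y_j$ if and only if $\mathcal{M}_{i,j}\neq 0$. The cell graph of $\mathcal{M}$ is the graph on the vertex set $\{(i,j):\mathcal{M}_{i,j}\neq 0\}$ in which $(i,j)\sim(k,\ell)$ if and only if $(i,j)$ and $(k,\ell)$ lie in the same row or the same column and there are no nonzero cells strictly between them in that row or column. -}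

module Defs where

open import Data.Nat using (ℕ; suc)
open import Data.Fin using (Fin; zero; suc; inject₁; fromℕ; _<_)
open import Data.Integer using (ℤ; +_; -[1+_]; NonZero)
open import Data.Product using (Σ; _×_; _,_)
open import Data.Sum using (_⊎_; inj₁; inj₂)
open import Data.Empty using (⊥)
open import Relation.Nullary using (¬_)
open import Relation.Binary.PropositionalEquality using (_≡_; _≢_)

-- A (simple) graph given by a vertex type and an adjacency relation.
-- A cycle: k = n+3 ≥ 3 pairwise distinct vertices v₀,…,v_{k-1} with
-- v_i ~ v_{i+1} for all i < k-1 and v_{k-1} ~ v₀.
record Cycle {V : Set} (E : V → V → Set) : Set where
  field
    n   : ℕ
    vs  : Fin (suc (suc (suc n))) → V
    inj : ∀ i j → vs i ≡ vs j → i ≡ j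
    adj : ∀ (i : Fin (suc (suc n))) → E (vs (inject₁ i)) (vs (suc i))
    close : E (vs (fromℕ (suc (suc n)))) (vs zero)

Forest : {V : Set} → (V → V → Set) → Set
Forest E = ¬ Cycle E

-- Matrix with t columns and u rows: M k ℓ is the entry in column k, row ℓ.
Matrix : ℕ → ℕ → Set
Matrix t u = Fin t → Fin u → ℤ

Entries01m1 : ∀ {t u} → Matrix t u → Set
Entries01m1 M = ∀ i j → (M i j ≡ + 0) ⊎ (M i j ≡ + 1) ⊎ (M i j ≡ -[1+ 0 ])

-- Row-column graph: vertices x_1..x_t (inj₁) and y_1..y_u (inj₂),
-- x_i ~ y_j iff M i j ≠ 0.
RCEdge : ∀ {t u} → Matrix t u → (Fin t ⊎ Fin u) → (Fin t ⊎ Fin u) → Set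
RCEdge M (inj₁ i) (inj₂ j) = NonZero (M i j)
RCEdge M (inj₂ j) (inj₁ i) = NonZero (M i j)
RCEdge M (inj₁ _) (inj₁ _) = ⊥
RCEdge M (inj₂ _) (inj₂ _) = ⊥

Between : ∀ {n} → Fin n → Fin n → Fin n → Set
Between a b m = (a < m × m < b) ⊎ (b < m × m < a)

Cell : ∀ {t u} → Matrix t u → Set
Cell {t} {u} M = Σ (Fin t × Fin u) (λ { (i , j) → NonZero (M i j) })

CellEdge : ∀ {t u} (M : Matrix t u) → Cell M → Cell M → Set
CellEdge M ((i , j) , _) ((k , l) , _) =
    (i ≡ k × j ≢ l × (∀ m → Between j l m → M i m ≡ + 0))
  ⊎ (j ≡ l × i ≢ k × (∀ m → Between i k m → M m j ≡ + 0))

-- Both graphs are finite and symmetric, so being a forest can be read as having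
-- no core: a nonempty vertex set in which every member has two distinct neighbours
-- inside the set.  The vertices of a cycle form a core (cycle→core); conversely a
-- core carries an infinite walk that never turns back (core→walk), which by the
-- pigeonhole principle revisits a vertex and, after shortcutting repetitions,
-- contains a cycle (walk→cycle).  forest-transfer packages this: E′ is a forest
-- whenever E is, provided every core of E′ induces a core of E.
--
-- After lemmas about a single
-- line (a column or a row): nearest nonzero entries and at most one neighbour on
-- each side, a core of the row-column graph yields the cells lying on its columns
-- and rows between its edges (FromRowColumnCore), and a core of the cell graph
-- yields the columns and rows containing two of its cells, whose extreme cells must
-- turn the corner (FromCellCore).  Only zero versus nonzero matters, so the
-- hypothesis that the entries lie in {0, 1, -1} is not needed.

module Submission where

open import Defs
open import Data.Nat as ℕ using (ℕ; zero; suc; _+_; _*_)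
import Data.Nat.Properties as ℕP
open import Data.Nat.Induction using (<-rec)
open import Data.Fin as Fin using (Fin; zero; suc; inject₁; fromℕ; toℕ; _<_; _≤_)
import Data.Fin.Properties as FinP
open import Data.Integer as ℤ using (ℤ; +_; -[1+_]; ∣_∣; NonZero)
open import Data.Product using (Σ; _×_; _,_; proj₁; proj₂)
open import Data.Sum using (_⊎_; inj₁; inj₂)
import Data.Sum.Properties as ⊎P
open import Data.Empty using (⊥-elim)
open import Function using (_∘_)
open import Function.Bundles using (_↣_; Injection; mk↣)
open import Relation.Nullary using (¬_; Dec; yes; no)
open import Relation.Nullary.Decidable using (_×-dec_; decidable-stable)
open import Relation.Binary.Definitions using (DecidableEquality; tri<; tri≈; tri>)
open import Relation.Binary.PropositionalEquality

TwoNeighboursIn : {V : Set} → (V → V → Set) → (V → Set) → V → Set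
TwoNeighboursIn {V} E P v = Σ V λ a → Σ V λ b → P a × P b × E v a × E v b × a ≢ b

record Core {V : Set} (E : V → V → Set) : Set₁ where
  field
    Member        : V → Set
    root          : V
    root-member   : Member root
    twoNeighbours : ∀ v → Member v → TwoNeighboursIn E Member v

record Walk {V : Set} (E : V → V → Set) : Set where
  field
    at          : ℕ → V
    step        : ∀ k → E (at k) (at (suc k))
    noBacktrack : ∀ k → at (suc (suc k)) ≢ at k

module _ {V : Set} {E : V → V → Set} where
  open Walk

  drop : Walk E → ℕ → Walk E
  drop W a = record
    { at = λ k → at W (k + a) ; step = λ k → step W (k + a) ; noBacktrack = λ k → noBacktrack W (k + a) }

  closeAt : (W : Walk E) {a b : ℕ} → a ℕ.< b → at W a ≡ at W b →
    Σ ℕ λ d → suc d + a ≡ b × at (drop W a) 0 ≡ at (drop W a) (suc d)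
  closeAt W {a} a<b same with ℕP.m≤n⇒∃[o]m+o≡n a<b
  ... | d , refl = d , length , trans same (cong (at W) (sym length))
    where
      length : suc d + a ≡ suc a + d
      length = cong suc (ℕP.+-comm d a)

  SimpleUpTo : Walk E → ℕ → Set
  SimpleUpTo W d = ∀ (x y : Fin (suc d)) → at W (toℕ x) ≡ at W (toℕ y) → x ≡ y

  RepeatUpTo : Walk E → ℕ → Set
  RepeatUpTo W d = Σ (Fin (suc d)) λ x → Σ (Fin (suc d)) λ y → x < y × at W (toℕ x) ≡ at W (toℕ y)

  repeat-or-simple : DecidableEquality V → ∀ W d → RepeatUpTo W d ⊎ SimpleUpTo W d
  repeat-or-simple _≟_ W d
    with FinP.any? (λ x → FinP.any? (λ y → (x FinP.<? y) ×-dec (at W (toℕ x) ≟ at W (toℕ y))))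
  ... | yes repeat = inj₁ repeat
  ... | no noRepeat = inj₂ simple
    where
      simple : SimpleUpTo W d
      simple x y same with FinP.<-cmp x y
      ... | tri< x<y _ _ = ⊥-elim (noRepeat (x , y , x<y , same))
      ... | tri≈ _ x≡y _ = x≡y
      ... | tri> _ _ y<x = ⊥-elim (noRepeat (y , x , y<x , sym same))

  module _ (irreflexive : ∀ v → ¬ E v v) where

    -- A closed walk of length d+1 ≥ 3 whose first d+1 vertices are distinct is a cycle;
    -- lengths 1 and 2 are excluded by irreflexivity and the absence of backtracking.
    simpleClosedWalk→cycle : (W : Walk E) (d : ℕ) → at W 0 ≡ at W (suc d) → SimpleUpTo W d → Cycle E
    simpleClosedWalk→cycle W zero closed _ =
      ⊥-elim (irreflexive (at W 0) (subst (E (at W 0)) (sym closed) (step W 0)))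
    simpleClosedWalk→cycle W (suc zero) closed _ = ⊥-elim (noBacktrack W 0 (sym closed))
    simpleClosedWalk→cycle W (suc (suc n)) closed simple = record
      { n = n ; vs = at W ∘ toℕ ; inj = simple ; adj = adj ; close = close }
      where
        adj : ∀ i → E (at W (toℕ (inject₁ i))) (at W (suc (toℕ i)))
        adj i rewrite FinP.toℕ-inject₁ i = step W (toℕ i)
        close : E (at W (toℕ (fromℕ (suc (suc n))))) (at W 0)
        close rewrite FinP.toℕ-fromℕ (suc (suc n)) =
          subst (E (at W (suc (suc n)))) (sym closed) (step W (suc (suc n)))

    -- Every closed walk contains a cycle: shorten it at a repeated vertex until it is simple
    -- (strong induction on the length).
    closedWalk→cycle : DecidableEquality V → (d : ℕ) (W : Walk E) → at W 0 ≡ at W (suc d) → Cycle E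
    closedWalk→cycle _≟_ = <-rec Goal shorten
      where
        Goal : ℕ → Set
        Goal d = (W : Walk E) → at W 0 ≡ at W (suc d) → Cycle E
        shorten : ∀ d → (∀ {d′} → d′ ℕ.< d → Goal d′) → Goal d
        shorten d shorter W closed with repeat-or-simple _≟_ W d
        ... | inj₂ simple = simpleClosedWalk→cycle W d closed simple
        ... | inj₁ (x , y , x<y , same) with closeAt W x<y same
        ...   | d′ , length , closed′ = shorter d′<d (drop W (toℕ x)) closed′
          where
            d′<d : d′ ℕ.< d
            d′<d = ℕP.≤-trans (subst (suc d′ ℕ.≤_) length (ℕP.m≤m+n (suc d′) (toℕ x)))
                              (ℕ.s≤s⁻¹ (FinP.toℕ<n y))

    -- In a finite graph every non-backtracking walk revisits a vertex (pigeonhole),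
    -- hence contains a cycle.
    walk→cycle : DecidableEquality V → {N : ℕ} → V ↣ Fin N → Walk E → Cycle E
    walk→cycle _≟_ {N} finite W
      with FinP.pigeonhole (ℕP.n<1+n N) (λ i → Injection.to finite (at W (toℕ i)))
    ... | i , j , i<j , same with closeAt W i<j (Injection.injective finite same)
    ...   | d , _ , closed = closedWalk→cycle _≟_ d (drop W (toℕ i)) closed

module _ {V : Set} {E : V → V → Set} (_≟_ : DecidableEquality V) (C : Core E) where
  open Core C

  neighbourAvoiding : ∀ v → Member v → (p : V) → Σ V λ w → Member w × E v w × w ≢ p
  neighbourAvoiding v v∈ p with twoNeighbours v v∈
  ... | a , b , a∈ , b∈ , va , vb , a≢b with a ≟ p
  ...   | yes refl = b , b∈ , vb , λ b≡a → a≢b (sym b≡a)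
  ...   | no a≢p   = a , a∈ , va , a≢p

  record Position : Set where
    constructor position
    field
      previous current : V
      current-member   : Member current
  open Position

  advance : Position → Position
  advance (position p v v∈) = position v (proj₁ next) (proj₁ (proj₂ next))
    where
      next : Σ V λ w → Member w × E v w × w ≢ p
      next = neighbourAvoiding v v∈ p

  -- The walk starts at the root, which serves as its own (harmless) previous vertex.
  positions : ℕ → Position
  positions zero    = position root root root-member
  positions (suc k) = advance (positions k)

  advance-edge : ∀ s → E (current s) (current (advance s))
  advance-edge (position p v v∈) = proj₁ (proj₂ (proj₂ (neighbourAvoiding v v∈ p)))

  advance-avoids : ∀ s → current (advance s) ≢ previous s
  advance-avoids (position p v v∈) = proj₂ (proj₂ (proj₂ (neighbourAvoiding v v∈ p)))

  core→walk : Walk E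
  core→walk = record
    { at = current ∘ positions
    ; step = advance-edge ∘ positions
    ; noBacktrack = advance-avoids ∘ advance ∘ positions
    }

lastOrInject₁ : ∀ {m} (j : Fin (suc m)) → j ≡ fromℕ m ⊎ Σ (Fin m) λ j′ → j ≡ inject₁ j′
lastOrInject₁ {zero}  zero    = inj₁ refl
lastOrInject₁ {suc m} zero    = inj₂ (zero , refl)
lastOrInject₁ {suc m} (suc j) with lastOrInject₁ j
... | inj₁ j≡last      = inj₁ (cong suc j≡last)
... | inj₂ (j′ , j≡j′) = inj₂ (suc j′ , cong suc j≡j′)

module _ {V : Set} {E : V → V → Set} (symmetric : ∀ {x y} → E x y → E y x) (cycle : Cycle E) where
  open Cycle cycle

  neighbourPositions : ∀ k → Σ (Fin (suc (suc (suc n)))) λ a → Σ (Fin (suc (suc (suc n)))) λ b →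
    E (vs k) (vs a) × E (vs k) (vs b) × a ≢ b
  neighbourPositions zero = suc zero , fromℕ (suc (suc n)) , adj zero , symmetric close , λ ()
  neighbourPositions (suc j) with lastOrInject₁ j
  ... | inj₁ refl = zero , inject₁ (fromℕ (suc n)) , close , symmetric (adj (fromℕ (suc n))) , λ ()
  ... | inj₂ (j′ , refl) =
    suc (suc j′) , inject₁ (inject₁ j′) , adj (suc j′) , symmetric (adj (inject₁ j′)) , apart
    where
      apart : suc (suc j′) ≢ inject₁ (inject₁ j′)
      apart same = ℕP.m≢1+n+m (toℕ j′) (sym (begin
        suc (suc (toℕ j′))            ≡⟨ cong toℕ same ⟩
        toℕ (inject₁ (inject₁ j′))    ≡⟨ FinP.toℕ-inject₁ (inject₁ j′) ⟩
        toℕ (inject₁ j′)              ≡⟨ FinP.toℕ-inject₁ j′ ⟩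
        toℕ j′                        ∎))
        where open ≡-Reasoning

  cycle→core : Core E
  cycle→core = record
    { Member = OnCycle ; root = vs zero ; root-member = zero , refl ; twoNeighbours = twoNeighbours }
    where
      OnCycle : V → Set
      OnCycle v = Σ (Fin (suc (suc (suc n)))) λ k → vs k ≡ v
      twoNeighbours : ∀ v → OnCycle v → TwoNeighboursIn E OnCycle v
      twoNeighbours v (k , refl) with neighbourPositions k
      ... | a , b , ka , kb , a≢b = vs a , vs b , (a , refl) , (b , refl) , ka , kb , a≢b ∘ inj a b

  cycle→core-decidable : DecidableEquality V → ∀ v → Dec (Core.Member cycle→core v)
  cycle→core-decidable _≟_ v = FinP.any? (λ k → vs k ≟ v)

forest-transfer : {V V′ : Set} {E : V → V → Set} {E′ : V′ → V′ → Set} {N : ℕ} →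
  DecidableEquality V → V ↣ Fin N → (∀ v → ¬ E v v) →
  DecidableEquality V′ → (∀ {x y} → E′ x y → E′ y x) →
  ((C : Core E′) → (∀ v → Dec (Core.Member C v)) → Core E) →
  Forest E → Forest E′
forest-transfer {E′ = E′} _≟_ finite irreflexive _≟′_ symmetric′ induce forest cycle′ =
  forest (walk→cycle irreflexive _≟_ finite (core→walk _≟_ (induce core′ decidable′)))
  where
    core′ : Core E′
    core′ = cycle→core symmetric′ cycle′
    decidable′ : ∀ v → Dec (Core.Member core′ v)
    decidable′ = cycle→core-decidable symmetric′ cycle′ _≟′_

nonZero-irrelevant : ∀ {x : ℤ} (p q : NonZero x) → p ≡ q
nonZero-irrelevant {+ suc _}   _ _ = refl
nonZero-irrelevant { -[1+ _ ]} _ _ = refl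

nonZero? : (x : ℤ) → Dec (NonZero x)
nonZero? x = ℕP.nonZero? ∣ x ∣

nonZero⇒≢0 : ∀ {x} → NonZero x → x ≢ + 0
nonZero⇒≢0 nz refl = ℕ.NonZero.nonZero nz

¬nonZero⇒≡0 : ∀ x → ¬ NonZero x → x ≡ + 0
¬nonZero⇒≡0 x ¬nz = decidable-stable (x ℤ.≟ + 0) (¬nz ∘ ℤ.≢-nonZero)

least : ∀ {n} {P : Fin n → Set} → (∀ k → Dec (P k)) → ∀ j → P j →
  Σ (Fin n) λ m → P m × (∀ k → k < m → ¬ P k)
least {suc n} P? j pj with P? zero
... | yes p0 = zero , p0 , λ _ ()
... | no ¬p0 with j
...   | zero   = ⊥-elim (¬p0 pj)
...   | suc j′ with least (P? ∘ suc) j′ pj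
...     | m , pm , below = suc m , pm , λ { zero _ → ¬p0 ; (suc k) k<m → below k (ℕ.s<s⁻¹ k<m) }

greatest : ∀ {n} {P : Fin n → Set} → (∀ k → Dec (P k)) → ∀ j → P j →
  Σ (Fin n) λ m → P m × (∀ k → m < k → ¬ P k)
greatest {suc n} P? j pj with FinP.any? (P? ∘ suc)
... | yes (k , pk) with greatest (P? ∘ suc) k pk
...   | m , pm , above = suc m , pm , λ { zero () ; (suc k) m<k → above k (ℕ.s<s⁻¹ m<k) }
greatest {suc n} P? zero    pj | no none = zero , pj , λ { zero () ; (suc k) _ pk → none (k , pk) }
greatest {suc n} P? (suc j) pj | no none = ⊥-elim (none (j , pj))

above-least : ∀ {n} {P : Fin n → Set} {m z : Fin n} → (∀ k → k < m → ¬ P k) → P z → m ≢ z → m < z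
above-least {m = m} {z} below pz m≢z with FinP.<-cmp m z
... | tri< m<z _ _ = m<z
... | tri≈ _ m≡z _ = ⊥-elim (m≢z m≡z)
... | tri> _ _ z<m = ⊥-elim (below z z<m pz)

below-greatest : ∀ {n} {P : Fin n → Set} {m z : Fin n} → (∀ k → m < k → ¬ P k) → P z → m ≢ z → z < m
below-greatest {m = m} {z} above pz m≢z with FinP.<-cmp m z
... | tri< m<z _ _ = ⊥-elim (above z m<z pz)
... | tri≈ _ m≡z _ = ⊥-elim (m≢z m≡z)
... | tri> _ _ z<m = z<m

OneSided : ∀ {n} → (Fin n → Set) → Fin n → Set
OneSided P j = ∀ {x y} → P x → P y → j ≢ x → j ≢ y → (j < x × j < y) ⊎ (x < j × y < j)

least-oneSided : ∀ {n} {P : Fin n → Set} {m : Fin n} → (∀ k → k < m → ¬ P k) → OneSided P m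
least-oneSided below px py m≢x m≢y = inj₁ (above-least below px m≢x , above-least below py m≢y)

greatest-oneSided : ∀ {n} {P : Fin n → Set} {m : Fin n} → (∀ k → m < k → ¬ P k) → OneSided P m
greatest-oneSided above px py m≢x m≢y = inj₂ (below-greatest above px m≢x , below-greatest above py m≢y)

least≢greatest : ∀ {n} {P : Fin n → Set} {lo hi a b : Fin n} →
  (∀ k → k < lo → ¬ P k) → (∀ k → hi < k → ¬ P k) → P a → P b → a ≢ b → lo ≢ hi
least≢greatest {P = P} {lo = lo} below above pa pb a≢b refl = a≢b (trans (atLo pa) (sym (atLo pb)))
  where
    atLo : ∀ {z} → P z → z ≡ lo
    atLo {z} pz with FinP.<-cmp z lo
    ... | tri< z<lo _ _ = ⊥-elim (below z z<lo pz)
    ... | tri≈ _ z≡lo _ = z≡lo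
    ... | tri> _ _ lo<z = ⊥-elim (above z lo<z pz)

-- A line of a matrix is a vector f : Fin n → ℤ (a column or a row). Two positions
-- of a line are adjacent when they differ and f vanishes strictly between them; this is
-- exactly the condition in the cell graph.

LineAdj : ∀ {n} → (Fin n → ℤ) → Fin n → Fin n → Set
LineAdj f a b = a ≢ b × (∀ k → Between a b k → f k ≡ + 0)

Between-sym : ∀ {n} {a b m : Fin n} → Between a b m → Between b a m
Between-sym (inj₁ a<m<b) = inj₂ a<m<b
Between-sym (inj₂ b<m<a) = inj₁ b<m<a

nearestAbove : ∀ {n} (f : Fin n → ℤ) {a b : Fin n} → a < b → NonZero (f b) →
  Σ (Fin n) λ m → NonZero (f m) × LineAdj f a m × a < m × m ≤ b
nearestAbove f {a} {b} a<b nzb with least P? b ((a<b , FinP.≤-refl) , nzb)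
  where
    P? : ∀ k → Dec ((a < k × k ≤ b) × NonZero (f k))
    P? k = ((a FinP.<? k) ×-dec (k FinP.≤? b)) ×-dec nonZero? (f k)
... | m , ((a<m , m≤b) , nzm) , first = m , nzm , (FinP.<⇒≢ a<m , zeros) , a<m , m≤b
  where
    zeros : ∀ k → Between a m k → f k ≡ + 0
    zeros k (inj₁ (a<k , k<m)) =
      ¬nonZero⇒≡0 (f k) (λ nzk → first k k<m ((a<k , FinP.≤-trans (ℕP.<⇒≤ k<m) m≤b) , nzk))
    zeros k (inj₂ (m<k , k<a)) = ⊥-elim (FinP.<-asym a<m (FinP.<-trans m<k k<a))

nearestBelow : ∀ {n} (f : Fin n → ℤ) {a b : Fin n} → b < a → NonZero (f b) →
  Σ (Fin n) λ m → NonZero (f m) × LineAdj f a m × b ≤ m × m < a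
nearestBelow f {a} {b} b<a nzb with greatest P? b ((FinP.≤-refl , b<a) , nzb)
  where
    P? : ∀ k → Dec ((b ≤ k × k < a) × NonZero (f k))
    P? k = ((b FinP.≤? k) ×-dec (k FinP.<? a)) ×-dec nonZero? (f k)
... | m , ((b≤m , m<a) , nzm) , first = m , nzm , (FinP.<⇒≢ m<a ∘ sym , zeros) , b≤m , m<a
  where
    zeros : ∀ k → Between a m k → f k ≡ + 0
    zeros k (inj₂ (m<k , k<a)) =
      ¬nonZero⇒≡0 (f k) (λ nzk → first k m<k ((FinP.≤-trans b≤m (ℕP.<⇒≤ m<k) , k<a) , nzk))
    zeros k (inj₁ (a<k , k<m)) = ⊥-elim (FinP.<-asym m<a (FinP.<-trans a<k k<m))

sameSideNeighbours : ∀ {n} (f : Fin n → ℤ) {a x y : Fin n} → LineAdj f a x → LineAdj f a y →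
  NonZero (f x) → NonZero (f y) → (a < x × a < y) ⊎ (x < a × y < a) → x ≡ y
sameSideNeighbours f {a} {x} {y} (_ , zx) (_ , zy) nzx nzy side with FinP.<-cmp x y | side
... | tri≈ _ x≡y _ | _                = x≡y
... | tri< x<y _ _ | inj₁ (a<x , _)   = ⊥-elim (nonZero⇒≢0 nzx (zy x (inj₁ (a<x , x<y))))
... | tri< x<y _ _ | inj₂ (_ , y<a)   = ⊥-elim (nonZero⇒≢0 nzy (zx y (inj₂ (x<y , y<a))))
... | tri> _ _ y<x | inj₁ (_ , a<y)   = ⊥-elim (nonZero⇒≢0 nzy (zx y (inj₁ (a<y , y<x))))
... | tri> _ _ y<x | inj₂ (x<a , _)   = ⊥-elim (nonZero⇒≢0 nzx (zy x (inj₂ (y<x , x<a))))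

Spanned : ∀ {n} → (Fin n → Set) → Fin n → Set
Spanned {n} Q m = Σ (Fin n) λ x → Σ (Fin n) λ y → Q x × Q y × x ≤ m × m ≤ y

self-spanned : ∀ {n} {Q : Fin n → Set} {j : Fin n} → Q j → Spanned Q j
self-spanned qj = _ , _ , qj , qj , FinP.≤-refl , FinP.≤-refl

LineNeighbour : ∀ {n} → (Fin n → ℤ) → (Fin n → Set) → Fin n → Fin n → Set
LineNeighbour f Q j m = NonZero (f m) × LineAdj f j m × Spanned Q m

module _ {n} (f : Fin n → ℤ) (Q : Fin n → Set) (Q⇒nonZero : ∀ {x} → Q x → NonZero (f x)) where

  neighbourToward : ∀ {j j′} → Q j → Q j′ → j ≢ j′ → Σ (Fin n) (LineNeighbour f Q j)
  neighbourToward {j} {j′} qj qj′ j≢j′ with FinP.<-cmp j j′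
  ... | tri≈ _ j≡j′ _ = ⊥-elim (j≢j′ j≡j′)
  ... | tri< j<j′ _ _ with nearestAbove f j<j′ (Q⇒nonZero qj′)
  ...   | m , nzm , adj , j<m , m≤j′ = m , nzm , adj , j , j′ , qj , qj′ , ℕP.<⇒≤ j<m , m≤j′
  neighbourToward {j} {j′} qj qj′ j≢j′ | tri> _ _ j′<j with nearestBelow f j′<j (Q⇒nonZero qj′)
  ...   | m , nzm , adj , j′≤m , m<j = m , nzm , adj , j′ , j , qj′ , qj , j′≤m , ℕP.<⇒≤ m<j

  endpoint-or-twoNeighbours : ∀ {j} → Spanned Q j →
    Q j ⊎ Σ (Fin n) λ m₁ → Σ (Fin n) λ m₂ → LineNeighbour f Q j m₁ × LineNeighbour f Q j m₂ × m₁ ≢ m₂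
  endpoint-or-twoNeighbours {j} (x , y , qx , qy , x≤j , j≤y) with x FinP.≟ j | y FinP.≟ j
  ... | yes refl | _        = inj₁ qx
  ... | no _     | yes refl = inj₁ qy
  ... | no x≢j   | no y≢j
    with nearestBelow f (FinP.≤∧≢⇒< x≤j x≢j) (Q⇒nonZero qx)
       | nearestAbove f (FinP.≤∧≢⇒< j≤y (y≢j ∘ sym)) (Q⇒nonZero qy)
  ... | m₁ , nz₁ , adj₁ , x≤m₁ , m₁<j | m₂ , nz₂ , adj₂ , j<m₂ , m₂≤y =
    inj₂ (m₁ , m₂ ,
          (nz₁ , adj₁ , x , y , qx , qy , x≤m₁ , FinP.≤-trans (ℕP.<⇒≤ m₁<j) j≤y) ,
          (nz₂ , adj₂ , x , y , qx , qy , FinP.≤-trans x≤j (ℕP.<⇒≤ j<m₂) , m₂≤y) ,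
          FinP.<⇒≢ (FinP.<-trans m₁<j j<m₂))

module _ {t u : ℕ} (M : Matrix t u) where

  rc-≟ : DecidableEquality (Fin t ⊎ Fin u)
  rc-≟ = ⊎P.≡-dec FinP._≟_ FinP._≟_

  rc-finite : (Fin t ⊎ Fin u) ↣ Fin (t + u)
  rc-finite = mk↣ {to = Fin.join t u} λ {x} {y} same →
    trans (sym (FinP.splitAt-join t u x)) (trans (cong (Fin.splitAt t) same) (FinP.splitAt-join t u y))

  rc-irreflexive : ∀ v → ¬ RCEdge M v v
  rc-irreflexive (inj₁ _) ()
  rc-irreflexive (inj₂ _) ()

  rc-symmetric : ∀ {x y} → RCEdge M x y → RCEdge M y x
  rc-symmetric {inj₁ _} {inj₂ _} e = e
  rc-symmetric {inj₂ _} {inj₁ _} e = e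

  -- The cell graph: a cell is determined by its position, so the same facts hold.

  cell-≡ : ∀ {i j} (p q : NonZero (M i j)) → _≡_ {A = Cell M} ((i , j) , p) ((i , j) , q)
  cell-≡ {i} {j} p q = cong (λ (nz : NonZero (M i j)) → ((i , j) , nz)) (nonZero-irrelevant {M i j} p q)

  cell-≟ : DecidableEquality (Cell M)
  cell-≟ ((i , j) , p) ((k , l) , q) with i FinP.≟ k | j FinP.≟ l
  ... | yes refl | yes refl = yes (cell-≡ p q)
  ... | no i≢k   | _        = no (i≢k ∘ cong (proj₁ ∘ proj₁))
  ... | yes _    | no j≢l   = no (j≢l ∘ cong (proj₂ ∘ proj₁))

  cell-finite : Cell M ↣ Fin (t * u)
  cell-finite = mk↣ {to = index} injective
    where
      index : Cell M → Fin (t * u)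
      index ((i , j) , _) = Fin.combine i j
      injective : ∀ {c d} → index c ≡ index d → c ≡ d
      injective {(i , j) , p} {(k , l) , q} same with FinP.combine-injective i j k l same
      ... | refl , refl = cell-≡ p q

  cell-irreflexive : ∀ c → ¬ CellEdge M c c
  cell-irreflexive _ (inj₁ (_ , j≢j , _)) = j≢j refl
  cell-irreflexive _ (inj₂ (_ , i≢i , _)) = i≢i refl

  cell-symmetric : ∀ {c d} → CellEdge M c d → CellEdge M d c
  cell-symmetric (inj₁ (refl , j≢l , zeros)) = inj₁ (refl , j≢l ∘ sym , λ m → zeros m ∘ Between-sym)
  cell-symmetric (inj₂ (refl , i≢k , zeros)) = inj₂ (refl , i≢k ∘ sym , λ m → zeros m ∘ Between-sym)

  -- A core of the row-column graph induces a core of the cell graph: the nonzero cells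
  -- lying on a core column between two core edges of it, or on a core row between two
  -- core edges of it.
  module FromRowColumnCore (C : Core (RCEdge M)) where
    open Core C

    CoreColumn : Fin t → Set
    CoreColumn i = Member (inj₁ i)

    CoreRow : Fin u → Set
    CoreRow j = Member (inj₂ j)

    ColumnEdge : Fin t → Fin u → Set
    ColumnEdge i j = CoreRow j × NonZero (M i j)

    RowEdge : Fin u → Fin t → Set
    RowEdge j i = CoreColumn i × NonZero (M i j)

    OnCoreSegment : Cell M → Set
    OnCoreSegment ((i , j) , _) = (CoreColumn i × Spanned (ColumnEdge i) j) ⊎ (CoreRow j × Spanned (RowEdge j) i)

    otherColumnEdge : ∀ {i} → CoreColumn i → (p : Fin u) → Σ (Fin u) λ j → ColumnEdge i j × j ≢ p
    otherColumnEdge {i} ci p with neighbourAvoiding rc-≟ C (inj₁ i) ci (inj₂ p)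
    ... | inj₂ j , cj , nz , j≢p = j , (cj , nz) , j≢p ∘ cong inj₂

    otherRowEdge : ∀ {j} → CoreRow j → (p : Fin t) → Σ (Fin t) λ i → RowEdge j i × i ≢ p
    otherRowEdge {j} cj p with neighbourAvoiding rc-≟ C (inj₂ j) cj (inj₁ p)
    ... | inj₁ i , ci , nz , i≢p = i , (ci , nz) , i≢p ∘ cong inj₁

    -- A core edge (i, j) has a neighbour towards another core edge of column i and
    -- one towards another core edge of row j.
    cornerNeighbours : ∀ {i j} (nz : NonZero (M i j)) → CoreColumn i → CoreRow j →
      TwoNeighboursIn (CellEdge M) OnCoreSegment ((i , j) , nz)
    cornerNeighbours {i} {j} nz ci cj with otherColumnEdge ci j | otherRowEdge cj i
    ... | j′ , ej′ , j′≢j | i′ , ei′ , i′≢i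
      with neighbourToward (M i) (ColumnEdge i) proj₂ (cj , nz) ej′ (j′≢j ∘ sym)
         | neighbourToward (λ k → M k j) (RowEdge j) proj₂ (ci , nz) ei′ (i′≢i ∘ sym)
    ... | m , nzm , adjm , spanm | m′ , nzm′ , adjm′ , spanm′ =
      ((i , m) , nzm) , ((m′ , j) , nzm′) , inj₁ (ci , spanm) , inj₂ (cj , spanm′) ,
      inj₁ (refl , adjm) , inj₂ (refl , adjm′) , proj₁ adjm ∘ sym ∘ cong (proj₂ ∘ proj₁)

    columnSegmentNeighbours : ∀ {i j} (nz : NonZero (M i j)) → CoreColumn i → Spanned (ColumnEdge i) j →
      TwoNeighboursIn (CellEdge M) OnCoreSegment ((i , j) , nz)
    columnSegmentNeighbours {i} nz ci span with endpoint-or-twoNeighbours (M i) (ColumnEdge i) proj₂ span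
    ... | inj₁ (cj , _) = cornerNeighbours nz ci cj
    ... | inj₂ (m₁ , m₂ , (nz₁ , adj₁ , span₁) , (nz₂ , adj₂ , span₂) , m₁≢m₂) =
      ((i , m₁) , nz₁) , ((i , m₂) , nz₂) , inj₁ (ci , span₁) , inj₁ (ci , span₂) ,
      inj₁ (refl , adj₁) , inj₁ (refl , adj₂) , m₁≢m₂ ∘ cong (proj₂ ∘ proj₁)

    rowSegmentNeighbours : ∀ {i j} (nz : NonZero (M i j)) → CoreRow j → Spanned (RowEdge j) i →
      TwoNeighboursIn (CellEdge M) OnCoreSegment ((i , j) , nz)
    rowSegmentNeighbours {j = j} nz cj span with endpoint-or-twoNeighbours (λ k → M k j) (RowEdge j) proj₂ span
    ... | inj₁ (ci , _) = cornerNeighbours nz ci cj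
    ... | inj₂ (m₁ , m₂ , (nz₁ , adj₁ , span₁) , (nz₂ , adj₂ , span₂) , m₁≢m₂) =
      ((m₁ , j) , nz₁) , ((m₂ , j) , nz₂) , inj₂ (cj , span₁) , inj₂ (cj , span₂) ,
      inj₂ (refl , adj₁) , inj₂ (refl , adj₂) , m₁≢m₂ ∘ cong (proj₁ ∘ proj₁)

    edgeCell : ∀ v → Member v → Σ (Cell M) OnCoreSegment
    edgeCell (inj₁ i) ci with twoNeighbours (inj₁ i) ci
    ... | inj₂ j , _ , cj , _ , nz , _ = ((i , j) , nz) , inj₁ (ci , self-spanned (cj , nz))
    edgeCell (inj₂ j) cj with twoNeighbours (inj₂ j) cj
    ... | inj₁ i , _ , ci , _ , nz , _ = ((i , j) , nz) , inj₂ (cj , self-spanned (ci , nz))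

    cellCore : Core (CellEdge M)
    cellCore = record
      { Member = OnCoreSegment
      ; root = proj₁ (edgeCell root root-member)
      ; root-member = proj₂ (edgeCell root root-member)
      ; twoNeighbours = λ { ((i , j) , nz) (inj₁ (ci , span)) → columnSegmentNeighbours nz ci span
                          ; ((i , j) , nz) (inj₂ (cj , span)) → rowSegmentNeighbours nz cj span }
      }

  -- A core of the cell graph with decidable membership induces a core of the
  -- row-column graph: the columns and rows containing two distinct core cells.
  module FromCellCore (C : Core (CellEdge M)) (member? : ∀ c → Dec (Core.Member C c)) where
    open Core C

    InCore : Fin t → Fin u → Set
    InCore i j = Σ (NonZero (M i j)) λ nz → Member ((i , j) , nz)

    inCore? : ∀ i j → Dec (InCore i j)
    inCore? i j with nonZero? (M i j)
    ... | no ¬nz = no (¬nz ∘ proj₁)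
    ... | yes nz with member? ((i , j) , nz)
    ...   | yes c∈ = yes (nz , c∈)
    ...   | no c∉  = no λ { (nz′ , c∈) → c∉ (subst Member (cell-≡ nz′ nz) c∈) }

    BusyColumn : Fin t → Set
    BusyColumn i = Σ (Fin u) λ j → Σ (Fin u) λ j′ → j ≢ j′ × InCore i j × InCore i j′

    BusyRow : Fin u → Set
    BusyRow j = Σ (Fin t) λ i → Σ (Fin t) λ i′ → i ≢ i′ × InCore i j × InCore i′ j

    Busy : Fin t ⊎ Fin u → Set
    Busy (inj₁ i) = BusyColumn i
    Busy (inj₂ j) = BusyRow j

    -- A core cell with the other core cells of its column on one side has at most one
    -- core neighbour in that column, so its other core neighbour lies in its row.
    oneSidedInColumn→busyRow : ∀ {i j} → InCore i j → OneSided (InCore i) j → BusyRow j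
    oneSidedInColumn→busyRow {i} {j} (nz , c∈) oneSided with twoNeighbours ((i , j) , nz) c∈
    ... | ((i′ , _) , nz′) , _ , a∈ , _ , inj₂ (refl , i≢i′ , _) , _ , _ = i , i′ , i≢i′ , (nz , c∈) , (nz′ , a∈)
    ... | _ , ((i′ , _) , nz′) , _ , b∈ , _ , inj₂ (refl , i≢i′ , _) , _ = i , i′ , i≢i′ , (nz , c∈) , (nz′ , b∈)
    ... | ((_ , ja) , na) , ((_ , jb) , nb) , a∈ , b∈ , inj₁ (refl , adjA) , inj₁ (refl , adjB) , a≢b
      with sameSideNeighbours (M i) adjA adjB na nb (oneSided (na , a∈) (nb , b∈) (proj₁ adjA) (proj₁ adjB))
    ...   | refl = ⊥-elim (a≢b (cell-≡ na nb))

    oneSidedInRow→busyColumn : ∀ {i j} → InCore i j → OneSided (λ k → InCore k j) i → BusyColumn i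
    oneSidedInRow→busyColumn {i} {j} (nz , c∈) oneSided with twoNeighbours ((i , j) , nz) c∈
    ... | ((_ , j′) , nz′) , _ , a∈ , _ , inj₁ (refl , j≢j′ , _) , _ , _ = j , j′ , j≢j′ , (nz , c∈) , (nz′ , a∈)
    ... | _ , ((_ , j′) , nz′) , _ , b∈ , _ , inj₁ (refl , j≢j′ , _) , _ = j , j′ , j≢j′ , (nz , c∈) , (nz′ , b∈)
    ... | ((ia , _) , na) , ((ib , _) , nb) , a∈ , b∈ , inj₂ (refl , adjA) , inj₂ (refl , adjB) , a≢b
      with sameSideNeighbours (λ k → M k j) adjA adjB na nb (oneSided (na , a∈) (nb , b∈) (proj₁ adjA) (proj₁ adjB))
    ...   | refl = ⊥-elim (a≢b (cell-≡ na nb))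

    -- The lowest and the highest core cells of a busy column lie in busy rows, and symmetrically.
    busyColumnNeighbours : ∀ {i} → BusyColumn i → TwoNeighboursIn (RCEdge M) Busy (inj₁ i)
    busyColumnNeighbours {i} (j , j′ , j≢j′ , cj , cj′)
      with least (inCore? i) j cj | greatest (inCore? i) j cj
    ... | lo , clo , belowLo | hi , chi , aboveHi =
      inj₂ lo , inj₂ hi ,
      oneSidedInColumn→busyRow clo (least-oneSided belowLo) ,
      oneSidedInColumn→busyRow chi (greatest-oneSided aboveHi) ,
      proj₁ clo , proj₁ chi , least≢greatest belowLo aboveHi cj cj′ j≢j′ ∘ ⊎P.inj₂-injective

    busyRowNeighbours : ∀ {j} → BusyRow j → TwoNeighboursIn (RCEdge M) Busy (inj₂ j)
    busyRowNeighbours {j} (i , i′ , i≢i′ , ci , ci′)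
      with least (λ k → inCore? k j) i ci | greatest (λ k → inCore? k j) i ci
    ... | lo , clo , belowLo | hi , chi , aboveHi =
      inj₁ lo , inj₁ hi ,
      oneSidedInRow→busyColumn clo (least-oneSided belowLo) ,
      oneSidedInRow→busyColumn chi (greatest-oneSided aboveHi) ,
      proj₁ clo , proj₁ chi , least≢greatest belowLo aboveHi ci ci′ i≢i′ ∘ ⊎P.inj₁-injective

    busyLine : ∀ c → Member c → Σ (Fin t ⊎ Fin u) Busy
    busyLine ((i , j) , nz) c∈ with twoNeighbours ((i , j) , nz) c∈
    ... | ((_ , j′) , nz′) , _ , a∈ , _ , inj₁ (refl , j≢j′ , _) , _ = inj₁ i , j , j′ , j≢j′ , (nz , c∈) , (nz′ , a∈)
    ... | ((i′ , _) , nz′) , _ , a∈ , _ , inj₂ (refl , i≢i′ , _) , _ = inj₂ j , i , i′ , i≢i′ , (nz , c∈) , (nz′ , a∈)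

    rcCore : Core (RCEdge M)
    rcCore = record
      { Member = Busy
      ; root = proj₁ (busyLine root root-member)
      ; root-member = proj₂ (busyLine root root-member)
      ; twoNeighbours = λ { (inj₁ i) busy → busyColumnNeighbours busy ; (inj₂ j) busy → busyRowNeighbours busy }
      }

proposition1p2 : (t u : ℕ) (M : Matrix t u) → Entries01m1 M →
    (Forest (RCEdge M) → Forest (CellEdge M)) × (Forest (CellEdge M) → Forest (RCEdge M))
proposition1p2 t u M _ =
    forest-transfer (rc-≟ M) (rc-finite M) (rc-irreflexive M) (cell-≟ M) (λ {c} {d} → cell-symmetric M {c} {d})
                    (FromCellCore.rcCore M)
  , forest-transfer (cell-≟ M) (cell-finite M) (cell-irreflexive M) (rc-≟ M) (rc-symmetric M)
                    (λ C _ → FromRowColumnCore.cellCore M C)
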